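{- Let $\mathbb{F}$ be a field of characteristic $2$ and $S$ a quasi-thin association scheme on a finite set $X$. If $S=O^\vartheta(S)O_\vartheta(S)$, then $S$ is $2$-transitive.
   Context: $S=\{R_0,\dots,R_d\}$ is an association scheme on $X$ with diagonal $R_0$, transposes $R_{i^*}$, intersection numbers $p_{ij}^k$, valencies $k_i=p_{ii^*}^0$; quasi-thin means $k_i\le2$ for all $i$. For nonempty $U,V\subseteq S$, $UV=\{R_k:\exists R_u\in U,R_v\in V,\ p_{uv}^k>0\}$. A nonempty $T\subseteq S$ is closed if $T^*T\subseteq T$ ($T^*=\{R_{i^*}:R_i\in T\}$), strongly normal if also $R_{i^*}TR_i\subseteq T$ for all $i$. $O_\vartheta(S)=\{R_i:k_i=1\}$; $O^\vartheta(S)$ is the intersection of all strongly normal closed subsets. $\overline{A_i}$ is the image in $M_X(\mathbb{F})$ of the adjacency matrix of $R_i$, $\mathbb{F}S=\mathrm{span}_{\mathbb{F}}\{\overline{A_i}\}$, $\overline{k_i}$ the image of $k_i$ in $\mathbb{F}$. A trivial submodule of the regular $\mathbb{F}S$-module is $\langle v\rangle_{\mathbb{F}}$ with $0\ne v\in\mathbb{F}S$ and $\overline{A_i}v=\overline{k_i}v$ for all $i$; $S$ is $2$-transitive if there is exactly one such submodule. -}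

module Defs where

open import Level using (Level; _⊔_) renaming (suc to lsuc)
open import Data.Nat using (ℕ; zero; suc; _≤_; _<_)
open import Data.Fin using (Fin; zero; suc)
open import Data.Fin.Subset using (Subset; _∈_; Nonempty)
open import Data.Product using (Σ; ∃; ∃-syntax; _×_; _,_)
open import Data.Bool using (Bool; true; false; if_then_else_; _∧_)
open import Relation.Nullary using (¬_; Dec; yes; no)
open import Relation.Nullary.Decidable using (⌊_⌋)
open import Relation.Binary.PropositionalEquality using (_≡_)
open import Data.Fin.Properties using () renaming (_≟_ to _≟F_)
open import Function.Bundles using (_⇔_)
open import Algebra.Bundles using (CommutativeRing)

record Field (c ℓ : Level) : Set (lsuc (c ⊔ ℓ)) where
  field
    commutativeRing : CommutativeRing c ℓ
  open CommutativeRing commutativeRing public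
  field
    1≉0     : ¬ (1# ≈ 0#)
    inverse : ∀ x → ¬ (x ≈ 0#) → ∃[ y ] (x * y ≈ 1#)

Char2 : ∀ {c ℓ} → Field c ℓ → Set ℓ
Char2 F = (1# + 1#) ≈ 0#
  where open Field F

count : ∀ {n} → (Fin n → Bool) → ℕ
count {zero}  P = 0
count {suc n} P = (if P zero then 1 else 0) Data.Nat.+ count (λ z → P (suc z))

-- Association schemes on X = Fin n with relations R_0,…,R_d
-- (indexed by Fin (suc d), R_0 = index zero).  rel x y = i means
-- (x,y) ∈ R_i; thus the R_i partition X × X.

record AssocScheme (n d : ℕ) : Set where
  field
    rel      : Fin n → Fin n → Fin (suc d)
    nonempty : ∀ i → ∃[ x ] ∃[ y ] (rel x y ≡ i)
    diag     : ∀ x y → (rel x y ≡ zero) ⇔ (x ≡ y)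
    tr       : Fin (suc d) → Fin (suc d)
    tr-spec  : ∀ x y → rel y x ≡ tr (rel x y)
    p        : Fin (suc d) → Fin (suc d) → Fin (suc d) → ℕ
    p-spec   : ∀ i j x y →
               count (λ z → ⌊ rel x z ≟F i ⌋ ∧ ⌊ rel z y ≟F j ⌋) ≡ p i j (rel x y)

  val : Fin (suc d) → ℕ
  val i = p i (tr i) zero

  _∈⟨_·_⟩ : Fin (suc d) → Subset (suc d) → Subset (suc d) → Set
  k ∈⟨ U · V ⟩ = ∃[ u ] ∃[ v ] (u ∈ U × v ∈ V × 0 < p u v k)

  Closed : Subset (suc d) → Set
  Closed T = Nonempty T ×
    (∀ i j k → i ∈ T → j ∈ T → 0 < p (tr i) j k → k ∈ T)

  StronglyNormal : Subset (suc d) → Set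
  StronglyNormal T = Closed T ×
    (∀ i k → (∃[ m ] ∃[ j ] (j ∈ T × 0 < p (tr i) j m × 0 < p m i k)) → k ∈ T)

  InOUpper : Fin (suc d) → Set
  InOUpper i = ∀ T → StronglyNormal T → i ∈ T

  InOLower : Fin (suc d) → Set
  InOLower i = val i ≡ 1

  QuasiThin : Set
  QuasiThin = ∀ i → val i ≤ 2

  GeneratedByOO : Set
  GeneratedByOO = ∀ k → ∃[ u ] ∃[ v ] (InOUpper u × InOLower v × 0 < p u v k)

module _ {c ℓ} (F : Field c ℓ) {n d : ℕ} (S : AssocScheme n d) where
  open Field F using (Carrier; _≈_; _+_; _*_; 0#; 1#)
  open AssocScheme S

  Σ𝔽 : ∀ {m} → (Fin m → Carrier) → Carrier
  Σ𝔽 {zero}  f = 0#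
  Σ𝔽 {suc m} f = f zero + Σ𝔽 (λ z → f (suc z))

  ι : ℕ → Carrier
  ι zero    = 0#
  ι (suc m) = 1# + ι m

  -- An element of 𝔽S = span{A_i} is Σ_i c_i A_i; given coefficients c,
  -- its matrix entry at (x,y) is c (rel x y).
  Coeffs : Set c
  Coeffs = Fin (suc d) → Carrier

  mat : Coeffs → Fin n → Fin n → Carrier
  mat v x y = v (rel x y)

  adjMul : Fin (suc d) → (Fin n → Fin n → Carrier) → Fin n → Fin n → Carrier
  adjMul i M x y = Σ𝔽 (λ z → (if ⌊ rel x z ≟F i ⌋ then 1# else 0#) * M z y)

  NonzeroElt : Coeffs → Set ℓ
  NonzeroElt v = ¬ (∀ x y → mat v x y ≈ 0#)

  TrivialGen : Coeffs → Set ℓ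
  TrivialGen v = NonzeroElt v ×
    (∀ i x y → adjMul i (mat v) x y ≈ ι (val i) * mat v x y)

  -- exactly one trivial submodule ⟨v⟩ of the regular 𝔽S-module
  TwoTransitive : Set (c ⊔ ℓ)
  TwoTransitive =
    (∃[ v ] TrivialGen v) ×
    (∀ v w → TrivialGen v → TrivialGen w →
       ∃[ λ₀ ] (∀ x y → mat w x y ≈ λ₀ * mat v x y))

-- Let v be a trivial element and write row a y = v (rel a y).  For a relation s and a point x,
-- the equation A_s v = k_s v sums the rows of the (at most two) s-neighbours of x to k_s times
-- the row of x.  In characteristic 2 this forces the two s-neighbours of x to have equal rows,
-- and for a thin s it gives the unique neighbour the row of x.  Call a and b linked if they are
-- joined by a chain of pairs with a common predecessor rel x a ≡ rel x b.  The relations all of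
-- whose pairs are linked contain R_0 and are closed under both rules defining strongly normal
-- closed subsets, so they contain O^θ(S).  Factoring any relation through an element of O^θ(S)
-- followed by a thin one then shows that all rows agree, so v is constant: every trivial element
-- is a multiple of the all-ones element, which is itself trivial.
module Submission where

open import Defs
open import Data.Nat using (ℕ)
open import Level using (Level)

open import Data.Bool using (Bool; true; false; if_then_else_; _∧_)
open import Data.Empty using (⊥-elim)
open import Data.Bool.Properties using (T-≡; ∧-conicalˡ; ∧-conicalʳ)
open import Data.Fin using (Fin; zero; suc)
open import Data.Fin.Properties using (_≟_; any?)
open import Data.Fin.Subset using (Subset; _∈_; _⊆_; ∣_∣; ⁅_⁆)
open import Data.Fin.Subset.Properties
  using (_∈?_; _⊂?_; ⊆-antisym; p⊂q⇒∣p∣<∣q∣; ∣p∣≤n; x∈⁅x⁆; x∈⁅y⁆⇒x≡y)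
open import Data.Nat as ℕ using (zero; suc; _<_; _≤_; z≤n; s≤s; _<?_)
open import Data.Nat.GeneralisedArithmetic using (fold)
open import Data.Nat.Properties
  using (<-≤-trans; <⇒≱; +-suc; +-cancelˡ-≤; n≤0⇒n≡0; suc-injective)
open import Data.Product using (∃-syntax; _×_; _,_)
open import Data.Sum using (_⊎_; inj₁; inj₂)
open import Data.Vec using (tabulate)
open import Data.Vec.Properties using (lookup∘tabulate; []=⇒lookup; lookup⇒[]=)
open import Function.Bundles using (Equivalence)
open import Level using (0ℓ)
open import Relation.Binary using (Rel; IsEquivalence)
import Relation.Binary.Construct.Closure.Equivalence as EqClosure
open EqClosure using (EqClosure)
open import Relation.Binary.PropositionalEquality
  using (_≡_; refl; sym; trans; cong; cong₂; subst)
open import Relation.Nullary using (Dec; yes; no; does; ¬_; contradiction)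
open import Relation.Nullary.Decidable
  using (⌊_⌋; toWitness; fromWitness; dec-true; _⊎-dec_; _×-dec_)
open import Relation.Unary using (Pred; Decidable)

⌊⌋≡true⇒ : ∀ {a} {A : Set a} (a? : Dec A) → ⌊ a? ⌋ ≡ true → A
⌊⌋≡true⇒ a? e = toWitness (Equivalence.from T-≡ e)

⇒⌊⌋≡true : ∀ {a} {A : Set a} (a? : Dec A) → A → ⌊ a? ⌋ ≡ true
⇒⌊⌋≡true a? a = Equivalence.to T-≡ (fromWitness a)

indicator : Bool → ℕ
indicator b = if b then 1 else 0

count-cong : ∀ {n} {P Q : Fin n → Bool} → (∀ w → P w ≡ Q w) → count P ≡ count Q
count-cong {zero}  e = refl
count-cong {suc n} e = cong₂ ℕ._+_ (cong indicator (e zero)) (count-cong (λ w → e (suc w)))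

0<count⇒∃ : ∀ {n} (P : Fin n → Bool) → 0 < count P → ∃[ z ] P z ≡ true
0<count⇒∃ {suc n} P h with P zero in e
... | true  = zero , e
... | false with 0<count⇒∃ (λ w → P (suc w)) h
...   | z , e′ = suc z , e′

∃⇒0<count : ∀ {n} (P : Fin n → Bool) z → P z ≡ true → 0 < count P
∃⇒0<count P zero    e rewrite e = s≤s z≤n
∃⇒0<count P (suc z) e with P zero
... | true  = s≤s z≤n
... | false = ∃⇒0<count (λ w → P (suc w)) z e

-- Tested with `does` rather than ⌊_⌋ so that `without P (suc z)` computes to
-- `P zero` at zero and to `without (P ∘ suc) z` on successors.
without : ∀ {n} → (Fin n → Bool) → Fin n → Fin n → Bool
without P z w = if does (w ≟ z) then false else P w

without-true : ∀ {n} {P : Fin n → Bool} {z w} → P w ≡ true → ¬ w ≡ z → without P z w ≡ true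
without-true {z = z} {w} e w≢z with w ≟ z
... | yes w≡z = contradiction w≡z w≢z
... | no _    = e

count-without : ∀ {n} (P : Fin n → Bool) z → P z ≡ true → count P ≡ suc (count (without P z))
count-without P zero    e rewrite e = refl
count-without P (suc z) e =
  trans (cong (indicator (P zero) ℕ.+_) (count-without (λ w → P (suc w)) z e))
        (+-suc (indicator (P zero)) _)

satisfying : ∀ {n} {P : Pred (Fin n) 0ℓ} → Decidable P → Subset n
satisfying P? = tabulate (λ k → does (P? k))

module _ {n} {P : Pred (Fin n) 0ℓ} (P? : Decidable P) where

  ∈-satisfying⁺ : ∀ {k} → P k → k ∈ satisfying P?
  ∈-satisfying⁺ {k} pk = lookup⇒[]= k _ (trans (lookup∘tabulate _ k) (dec-true (P? k) pk))

  ∈-satisfying⁻ : ∀ {k} → k ∈ satisfying P? → P k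
  ∈-satisfying⁻ {k} k∈ with P? k | trans (sym (lookup∘tabulate _ k)) ([]=⇒lookup k∈)
  ... | yes pk | _  = pk
  ... | no _   | ()

module Closure {D : ℕ} (Step : Subset D → Pred (Fin D) 0ℓ)
               (step? : ∀ T → Decidable (Step T)) where

  ∈-or-step? : ∀ T → Decidable (λ k → k ∈ T ⊎ Step T k)
  ∈-or-step? T k = k ∈? T ⊎-dec step? T k

  grow : Subset D → Subset D
  grow T = satisfying (∈-or-step? T)

  grow-inflationary : ∀ {T} → T ⊆ grow T
  grow-inflationary {T} k∈T = ∈-satisfying⁺ (∈-or-step? T) (inj₁ k∈T)

  stable-or-grows : ∀ T → grow T ⊆ T ⊎ ∣ T ∣ < ∣ grow T ∣
  stable-or-grows T with T ⊂? grow T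
  ... | yes T⊂growT = inj₂ (p⊂q⇒∣p∣<∣q∣ T⊂growT)
  ... | no ¬T⊂growT = inj₁ stable
    where
      stable : grow T ⊆ T
      stable {k} k∈growT with k ∈? T
      ... | yes k∈T = k∈T
      ... | no k∉T  = ⊥-elim (¬T⊂growT (grow-inflationary , k , k∈growT , k∉T))

  stable-grow : ∀ {T} → grow T ⊆ T → grow (grow T) ⊆ grow T
  stable-grow {T} stable = subst (λ U → grow U ⊆ U) (sym (⊆-antisym stable grow-inflationary)) stable

  stage : Subset D → ℕ → Subset D
  stage T = fold T grow

  stable-or-large : ∀ T m → grow (stage T m) ⊆ stage T m ⊎ m ≤ ∣ stage T m ∣
  stable-or-large T zero    = inj₂ z≤n
  stable-or-large T (suc m) with stable-or-large T m
  ... | inj₁ stable = inj₁ (stable-grow stable)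
  ... | inj₂ large with stable-or-grows (stage T m)
  ...   | inj₁ stable = inj₁ (stable-grow stable)
  ...   | inj₂ grows  = inj₂ (<-≤-trans (s≤s large) grows)

  -- A stage still growing after suc D rounds would have more than D elements.
  closure : Subset D → Subset D
  closure T = stage T (suc D)

  closure-stable : ∀ T → grow (closure T) ⊆ closure T
  closure-stable T with stable-or-large T (suc D)
  ... | inj₁ stable = stable
  ... | inj₂ large  = contradiction (∣p∣≤n (closure T)) (<⇒≱ large)

  ⊆-closure : ∀ {T} → T ⊆ closure T
  ⊆-closure {T} = ⊆-stage (suc D)
    where
      ⊆-stage : ∀ m → T ⊆ stage T m
      ⊆-stage zero    k∈T = k∈T
      ⊆-stage (suc m) k∈T = grow-inflationary (⊆-stage m k∈T)

  closure-closed : ∀ {T k} → Step (closure T) k → k ∈ closure T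
  closure-closed {T} step = closure-stable T (∈-satisfying⁺ (∈-or-step? (closure T)) (inj₂ step))

  closure-ind : ∀ {ℓ} (Q : Pred (Fin D) ℓ) {T} →
                (∀ {k} → k ∈ T → Q k) →
                (∀ {U k} → (∀ {j} → j ∈ U → Q j) → Step U k → Q k) →
                ∀ {k} → k ∈ closure T → Q k
  closure-ind Q {T} base step = stage-ind (suc D)
    where
      stage-ind : ∀ m {k} → k ∈ stage T m → Q k
      stage-ind zero    k∈ = base k∈
      stage-ind (suc m) k∈ with ∈-satisfying⁻ (∈-or-step? (stage T m)) k∈
      ... | inj₁ k∈prev = stage-ind m k∈prev
      ... | inj₂ st     = step (stage-ind m) st

module Scheme {n d : ℕ} (S : AssocScheme n d) where
  open AssocScheme S

  rel-refl : ∀ x → rel x x ≡ zero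
  rel-refl x = Equivalence.from (diag x x) refl

  rel-swap-cong : ∀ {x y z w} → rel x y ≡ rel z w → rel y x ≡ rel w z
  rel-swap-cong {x} {y} {z} {w} e = trans (tr-spec x y) (trans (cong tr e) (sym (tr-spec z w)))

  tr-involutive : ∀ i → tr (tr i) ≡ i
  tr-involutive i with nonempty i
  ... | x , y , refl = sym (trans (tr-spec y x) (cong tr (tr-spec x y)))

  rel-tr : ∀ {x y i} → rel x y ≡ tr i → rel y x ≡ i
  rel-tr {x} {y} {i} e = trans (tr-spec x y) (trans (cong tr e) (tr-involutive i))

  p-pos : ∀ x z y → 0 < p (rel x z) (rel z y) (rel x y)
  p-pos x z y = subst (0 <_) (p-spec (rel x z) (rel z y) x y)
    (∃⇒0<count (λ w → ⌊ rel x w ≟ rel x z ⌋ ∧ ⌊ rel w y ≟ rel z y ⌋) z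
      (cong₂ _∧_ (⇒⌊⌋≡true (rel x z ≟ rel x z) refl)
                 (⇒⌊⌋≡true (rel z y ≟ rel z y) refl)))

  rel-factor : ∀ {i j k x y} → rel x y ≡ k → 0 < p i j k → ∃[ z ] (rel x z ≡ i × rel z y ≡ j)
  rel-factor {i} {j} {x = x} {y} refl pos with 0<count⇒∃ _ (subst (0 <_) (sym (p-spec i j x y)) pos)
  ... | z , e = z , ⌊⌋≡true⇒ (rel x z ≟ i) (∧-conicalˡ _ _ e)
                  , ⌊⌋≡true⇒ (rel z y ≟ j) (∧-conicalʳ _ _ e)

  ∃-rel : ∀ x i → ∃[ z ] rel x z ≡ i
  ∃-rel x i with nonempty i
  ... | x₀ , y₀ , refl with rel-factor (trans (rel-refl x) (sym (rel-refl x₀))) (p-pos x₀ y₀ x₀)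
  ...   | z , e , _ = z , e

  count-rel : ∀ x s → count (λ w → ⌊ rel x w ≟ s ⌋) ≡ val s
  count-rel x s =
    trans (count-cong on-both-sides) (trans (p-spec s (tr s) x x) (cong (p s (tr s)) (rel-refl x)))
    where
      on-both-sides : ∀ w → ⌊ rel x w ≟ s ⌋ ≡ ⌊ rel x w ≟ s ⌋ ∧ ⌊ rel w x ≟ tr s ⌋
      on-both-sides w with rel x w ≟ s
      ... | yes e = sym (⇒⌊⌋≡true (rel w x ≟ tr s) (trans (tr-spec x w) (cong tr e)))
      ... | no _  = refl

  Sibling : Rel (Fin n) 0ℓ
  Sibling a b = ∃[ x ] rel x a ≡ rel x b

  Linked : Rel (Fin n) 0ℓ
  Linked = EqClosure Sibling

  Transports : Rel (Fin n) 0ℓ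
  Transports b c = ∀ {a d} → rel b a ≡ rel c d → Linked a d

  transports-isEquivalence : IsEquivalence Transports
  transports-isEquivalence = record
    { refl  = λ {b} e → EqClosure.return (b , e)
    ; sym   = λ t e → EqClosure.symmetric Sibling (t (sym e))
    ; trans = λ {b} {w} t₁ t₂ {a} e → let a′ , e′ = ∃-rel w (rel b a) in
                EqClosure.transitive Sibling (t₁ (sym e′)) (t₂ (trans e′ e))
    }

  sibling-transports : ∀ {b c} → Sibling b c → Transports b c
  sibling-transports {b} {c} (x , xb≡xc) {a} {d} ba≡cd
    with rel-factor (sym xb≡xc) (p-pos x a b)
  ... | a′ , xa′≡xa , a′c≡ab =
    EqClosure.transitive Sibling (EqClosure.return (x , sym xa′≡xa))
                                 (EqClosure.return (c , trans (rel-swap-cong a′c≡ab) ba≡cd))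

  linked-transports : ∀ {b c} → Linked b c → Transports b c
  linked-transports = EqClosure.fold transports-isEquivalence sibling-transports

  AllLinked : Pred (Fin (suc d)) 0ℓ
  AllLinked k = ∀ {z z′} → rel z z′ ≡ k → Linked z z′

  allLinked-diagonal : AllLinked zero
  allLinked-diagonal {z} {z′} e with Equivalence.to (diag z z′) e
  ... | refl = EqClosure.reflexive Sibling

  allLinked-product : ∀ {i j k} → AllLinked i → AllLinked j → 0 < p (tr i) j k → AllLinked k
  allLinked-product linked-i linked-j pos zz′≡k with rel-factor zz′≡k pos
  ... | w , zw≡i* , wz′≡j =
    EqClosure.transitive Sibling (EqClosure.symmetric Sibling (linked-i (rel-tr zw≡i*))) (linked-j wz′≡j)

  allLinked-conjugate : ∀ {i j m k} → AllLinked j → 0 < p (tr i) j m → 0 < p m i k → AllLinked k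
  allLinked-conjugate linked-j pos₁ pos₂ zz′≡k with rel-factor zz′≡k pos₂
  ... | w , zw≡m , wz′≡i with rel-factor zw≡m pos₁
  ...   | u , zu≡i* , uw≡j = linked-transports (linked-j uw≡j) (trans (rel-tr zu≡i*) (sym wz′≡i))

  ProductStep : Subset (suc d) → Pred (Fin (suc d)) 0ℓ
  ProductStep T k = ∃[ i ] ∃[ j ] (i ∈ T × j ∈ T × 0 < p (tr i) j k)

  ConjugateStep : Subset (suc d) → Pred (Fin (suc d)) 0ℓ
  ConjugateStep T k = ∃[ i ] ∃[ m ] ∃[ j ] (j ∈ T × 0 < p (tr i) j m × 0 < p m i k)

  NormalClosureStep : Subset (suc d) → Pred (Fin (suc d)) 0ℓ
  NormalClosureStep T k = ProductStep T k ⊎ ConjugateStep T k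

  normalClosureStep? : ∀ T → Decidable (NormalClosureStep T)
  normalClosureStep? T k =
    any? (λ i → any? (λ j → i ∈? T ×-dec j ∈? T ×-dec 0 <? p (tr i) j k)) ⊎-dec
    any? (λ i → any? (λ m → any? (λ j → j ∈? T ×-dec 0 <? p (tr i) j m ×-dec 0 <? p m i k)))

  open Closure NormalClosureStep normalClosureStep?

  -- AllLinked is not decidable, so instead of O^θ(S) itself we use an explicitly computed
  -- strongly normal closed subset, which contains O^θ(S) and consists of AllLinked relations.
  normalClosure : Subset (suc d)
  normalClosure = closure ⁅ zero ⁆

  normalClosure-stronglyNormal : StronglyNormal normalClosure
  normalClosure-stronglyNormal =
    ((zero , ⊆-closure (x∈⁅x⁆ zero)) ,
     λ i j k i∈ j∈ pos → closure-closed (inj₁ (i , j , i∈ , j∈ , pos))) ,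
    λ i k (m , j , j∈ , pos₁ , pos₂) → closure-closed (inj₂ (i , m , j , j∈ , pos₁ , pos₂))

  normalClosure-allLinked : ∀ {k} → k ∈ normalClosure → AllLinked k
  normalClosure-allLinked = closure-ind AllLinked base step
    where
      base : ∀ {k} → k ∈ ⁅ zero ⁆ → AllLinked k
      base k∈ rewrite x∈⁅y⁆⇒x≡y zero k∈ = allLinked-diagonal
      step : ∀ {U k} → (∀ {j} → j ∈ U → AllLinked j) → NormalClosureStep U k → AllLinked k
      step linked (inj₁ (i , j , i∈ , j∈ , pos)) = allLinked-product (linked i∈) (linked j∈) pos
      step linked (inj₂ (i , m , j , j∈ , pos₁ , pos₂)) = allLinked-conjugate (linked j∈) pos₁ pos₂

  upper⇒allLinked : ∀ {u} → InOUpper u → AllLinked u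
  upper⇒allLinked u∈ = normalClosure-allLinked (u∈ normalClosure normalClosure-stronglyNormal)

module FilteredSum {c ℓ} (F : Field c ℓ) {n d : ℕ} (S : AssocScheme n d) where
  open Field F hiding (zero) renaming (refl to ≈-refl; sym to ≈-sym; trans to ≈-trans)
  open import Algebra.Properties.CommutativeSemigroup +-commutativeSemigroup using (x∙yz≈y∙xz)
  open import Relation.Binary.Reasoning.Setoid setoid

  sumWhere : ∀ {m} → (Fin m → Bool) → (Fin m → Carrier) → Carrier
  sumWhere P h = Σ𝔽 F S (λ w → (if P w then 1# else 0#) * h w)

  sumWhere-none : ∀ {m} (P : Fin m → Bool) h → count P ≡ 0 → sumWhere P h ≈ 0#
  sumWhere-none {zero}  P h _ = ≈-refl
  sumWhere-none {suc m} P h e with P zero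
  ... | false =
    ≈-trans (+-cong (zeroˡ _) (sumWhere-none (λ w → P (suc w)) (λ w → h (suc w)) e)) (+-identityˡ 0#)

  sumWhere-without : ∀ {m} (P : Fin m → Bool) h z → P z ≡ true →
                     sumWhere P h ≈ h z + sumWhere (without P z) h
  sumWhere-without P h zero e rewrite e =
    +-cong (*-identityˡ _) (≈-sym (≈-trans (+-congʳ (zeroˡ _)) (+-identityˡ _)))
  sumWhere-without P h (suc z) e = begin
    head + sumWhere (λ w → P (suc w)) (λ w → h (suc w))
      ≈⟨ +-congˡ (sumWhere-without (λ w → P (suc w)) (λ w → h (suc w)) z e) ⟩
    head + (h (suc z) + sumWhere (without (λ w → P (suc w)) z) (λ w → h (suc w)))
      ≈⟨ x∙yz≈y∙xz _ _ _ ⟩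
    h (suc z) + sumWhere (without P (suc z)) h ∎
    where head = (if P zero then 1# else 0#) * h zero

  sumWhere-ones : ∀ {m} (P : Fin m → Bool) → sumWhere P (λ _ → 1#) ≈ ι F S (count P)
  sumWhere-ones {zero}  P = ≈-refl
  sumWhere-ones {suc m} P with P zero
  ... | true  = +-cong (*-identityˡ 1#) (sumWhere-ones (λ w → P (suc w)))
  ... | false = ≈-trans (+-cong (zeroˡ 1#) (sumWhere-ones (λ w → P (suc w)))) (+-identityˡ _)

allOnes-trivial : ∀ {c ℓ} (F : Field c ℓ) {n d} (S : AssocScheme n d) →
                  TrivialGen F S (λ _ → Field.1# F)
allOnes-trivial F S = ones≢0 , harmonic
  where
    open Field F hiding (zero) renaming (refl to ≈-refl; sym to ≈-sym; trans to ≈-trans)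
    open import Relation.Binary.Reasoning.Setoid setoid
    open AssocScheme S
    open Scheme S
    open FilteredSum F S
    ones≢0 : NonzeroElt F S (λ _ → 1#)
    ones≢0 ones≈0 with nonempty zero
    ... | x , y , _ = 1≉0 (ones≈0 x y)
    harmonic : ∀ i x y → adjMul F S i (λ _ _ → 1#) x y ≈ ι F S (val i) * 1#
    harmonic i x y = begin
      sumWhere (λ z → ⌊ rel x z ≟ i ⌋) (λ _ → 1#) ≈⟨ sumWhere-ones (λ z → ⌊ rel x z ≟ i ⌋) ⟩
      ι F S (count (λ z → ⌊ rel x z ≟ i ⌋))       ≡⟨ cong (ι F S) (count-rel x i) ⟩
      ι F S (val i)                               ≈⟨ ≈-sym (*-identityʳ _) ⟩
      ι F S (val i) * 1#                          ∎

module Characteristic2 {c ℓ} (F : Field c ℓ) (char2 : Char2 F) where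
  open Field F renaming (refl to ≈-refl; sym to ≈-sym; trans to ≈-trans)
  open import Relation.Binary.Reasoning.Setoid setoid

  x+x≈0 : ∀ x → x + x ≈ 0#
  x+x≈0 x = begin
    x + x             ≈⟨ ≈-sym (+-cong (*-identityʳ x) (*-identityʳ x)) ⟩
    x * 1# + x * 1#   ≈⟨ ≈-sym (distribˡ x 1# 1#) ⟩
    x * (1# + 1#)     ≈⟨ *-congˡ char2 ⟩
    x * 0#            ≈⟨ zeroʳ x ⟩
    0#                ∎

  x+y≈0⇒x≈y : ∀ {x y} → x + y ≈ 0# → x ≈ y
  x+y≈0⇒x≈y {x} {y} x+y≈0 = begin
    x             ≈⟨ ≈-sym (+-identityʳ x) ⟩
    x + 0#        ≈⟨ +-congˡ (≈-sym (x+x≈0 y)) ⟩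
    x + (y + y)   ≈⟨ ≈-sym (+-assoc x y y) ⟩
    (x + y) + y   ≈⟨ +-congʳ x+y≈0 ⟩
    0# + y        ≈⟨ +-identityˡ y ⟩
    y             ∎

module TrivialElement {c ℓ} (F : Field c ℓ) (char2 : Char2 F) {n d : ℕ} (S : AssocScheme n d)
                      (quasiThin : AssocScheme.QuasiThin S) where
  open Field F hiding (zero) renaming (refl to ≈-refl; sym to ≈-sym; trans to ≈-trans)
  open import Relation.Binary.Reasoning.Setoid setoid
  open import Data.Vec.Functional.Relation.Binary.Equality.Setoid setoid using (_≋_; ≋-isEquivalence)
  open AssocScheme S
  open Scheme S
  open FilteredSum F S
  open Characteristic2 F char2

  ι2≈0 : ι F S 2 ≈ 0#
  ι2≈0 = ≈-trans (+-congˡ (+-identityʳ 1#)) char2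

  module _ (v : Coeffs F S)
           (harmonic : ∀ i x y → adjMul F S i (mat F S v) x y ≈ ι F S (val i) * mat F S v x y) where

    row : Fin n → Fin n → Carrier
    row a y = v (rel a y)

    -- Distinct siblings a, b are s-neighbours of x for s = rel x a, and by quasi-thinness the only
    -- ones, so the equation A_s v = k_s v at (x, y) reads row a y + row b y = 2 · row x y = 0.
    sibling⇒row≋ : ∀ {a b} → Sibling a b → row a ≋ row b
    sibling⇒row≋ {a} {b} (x , xa≡xb) y with a ≟ b
    ... | yes refl = ≈-refl
    ... | no a≢b   = x+y≈0⇒x≈y (begin
      row a y + row b y                      ≈⟨ +-congˡ (≈-sym (+-identityʳ _)) ⟩
      row a y + (row b y + 0#)               ≈⟨ +-congˡ (+-congˡ (≈-sym (sumWhere-none P₂ _ rest≡0))) ⟩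
      row a y + (row b y + sumWhere P₂ (λ w → row w y))
                                             ≈⟨ +-congˡ (≈-sym (sumWhere-without P₁ _ b b∈P₁)) ⟩
      row a y + sumWhere P₁ (λ w → row w y)  ≈⟨ ≈-sym (sumWhere-without P _ a a∈P) ⟩
      sumWhere P (λ w → row w y)             ≈⟨ harmonic s x y ⟩
      ι F S (val s) * row x y                ≡⟨ cong (λ k → ι F S k * row x y) val≡2 ⟩
      ι F S 2 * row x y                      ≈⟨ *-congʳ ι2≈0 ⟩
      0# * row x y                           ≈⟨ zeroˡ _ ⟩
      0#                                     ∎)
      where
        s  = rel x a
        P  = λ w → ⌊ rel x w ≟ s ⌋
        P₁ = without P a
        P₂ = without P₁ b
        a∈P : P a ≡ true
        a∈P = ⇒⌊⌋≡true (s ≟ s) refl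
        b∈P₁ : P₁ b ≡ true
        b∈P₁ = without-true {P = P} (⇒⌊⌋≡true (rel x b ≟ s) (sym xa≡xb)) (λ b≡a → a≢b (sym b≡a))
        val≡2+rest : val s ≡ 2 ℕ.+ count P₂
        val≡2+rest = trans (sym (count-rel x s))
                       (trans (count-without P a a∈P) (cong suc (count-without P₁ b b∈P₁)))
        rest≡0 : count P₂ ≡ 0
        rest≡0 = n≤0⇒n≡0 (+-cancelˡ-≤ 2 _ 0 (subst (ℕ._≤ 2) val≡2+rest (quasiThin s)))
        val≡2 : val s ≡ 2
        val≡2 = trans val≡2+rest (cong (2 ℕ.+_) rest≡0)

    thin⇒row≋ : ∀ {w z u} → rel w z ≡ u → val u ≡ 1 → row z ≋ row w
    thin⇒row≋ {w} {z} {u} wz≡u val≡1 y = begin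
      row z y                          ≈⟨ ≈-sym (+-identityʳ _) ⟩
      row z y + 0#                     ≈⟨ +-congˡ (≈-sym (sumWhere-none P₁ _ rest≡0)) ⟩
      row z y + sumWhere P₁ (λ w′ → row w′ y)
                                       ≈⟨ ≈-sym (sumWhere-without P _ z z∈P) ⟩
      sumWhere P (λ w′ → row w′ y)     ≈⟨ harmonic u w y ⟩
      ι F S (val u) * row w y          ≡⟨ cong (λ k → ι F S k * row w y) val≡1 ⟩
      ι F S 1 * row w y                ≈⟨ *-congʳ (+-identityʳ 1#) ⟩
      1# * row w y                     ≈⟨ *-identityˡ _ ⟩
      row w y                          ∎
      where
        P  = λ w′ → ⌊ rel w w′ ≟ u ⌋
        P₁ = without P z
        z∈P : P z ≡ true
        z∈P = ⇒⌊⌋≡true (rel w z ≟ u) wz≡u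
        rest≡0 : count P₁ ≡ 0
        rest≡0 = suc-injective (trans (sym (count-without P z z∈P)) (trans (count-rel w u) val≡1))

    linked⇒row≋ : ∀ {a b} → Linked a b → row a ≋ row b
    linked⇒row≋ = EqClosure.gfold (≋-isEquivalence n) row sibling⇒row≋

    constant : GeneratedByOO → ∀ k → v k ≈ v zero
    constant generated k with generated k | nonempty k
    ... | u , t , u∈upper , t-thin , pos | x , y , refl with rel-factor refl pos
    ...   | w , xw≡u , wy≡t = begin
      row x y   ≈⟨ linked⇒row≋ (upper⇒allLinked u∈upper xw≡u) y ⟩
      row w y   ≈⟨ ≈-sym (thin⇒row≋ wy≡t t-thin y) ⟩
      row y y   ≡⟨ cong v (rel-refl y) ⟩
      v zero    ∎

  proportional : AssocScheme.GeneratedByOO S → ∀ v w → TrivialGen F S v → TrivialGen F S w →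
                 ∃[ λ₀ ] (∀ x y → mat F S w x y ≈ λ₀ * mat F S v x y)
  proportional generated v w (v≢0 , v-harmonic) (_ , w-harmonic) with inverse (v zero) v₀≉0
    where
      v₀≉0 : ¬ v zero ≈ 0#
      v₀≉0 v₀≈0 = v≢0 (λ x y → ≈-trans (constant v v-harmonic generated (rel x y)) v₀≈0)
  ... | v₀⁻¹ , v₀v₀⁻¹≈1 = w zero * v₀⁻¹ , λ x y → begin
    w (rel x y)                  ≈⟨ constant w w-harmonic generated (rel x y) ⟩
    w zero                       ≈⟨ ≈-sym (*-identityʳ _) ⟩
    w zero * 1#                  ≈⟨ *-congˡ (≈-sym v₀v₀⁻¹≈1) ⟩
    w zero * (v zero * v₀⁻¹)     ≈⟨ *-congˡ (*-comm _ _) ⟩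
    w zero * (v₀⁻¹ * v zero)     ≈⟨ ≈-sym (*-assoc _ _ _) ⟩
    (w zero * v₀⁻¹) * v zero     ≈⟨ *-congˡ (≈-sym (constant v v-harmonic generated (rel x y))) ⟩
    (w zero * v₀⁻¹) * v (rel x y) ∎

corollary3p16 : ∀ {c ℓ : Level} (F : Field c ℓ) → Char2 F →
    ∀ (n d : ℕ) (S : AssocScheme n d) →
    AssocScheme.QuasiThin S →
    AssocScheme.GeneratedByOO S →
    TwoTransitive F S
corollary3p16 F char2 n d S quasiThin generated =
  (_ , allOnes-trivial F S) , proportional generated
  where open TrivialElement F char2 S quasiThin
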